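{- For every $\epsilon>0$ there are $K>0$ and $C>0$ such that the following holds. Let $P$ be the product of all primes smaller than $K$, let $a,b\in\mathbb{Z}$, $q\in\mathbb{Z}_{>0}$, and $T>C\log\max\{q,|a|,2\}$. Then \[ \left|\left\{ (x,y)\in\mathbb{Z}^{2}: (a+xq,b+yq)_{Pq}\neq1,\ |x|\le T,\ |y|\le T\right\}\right| \le\epsilon T^{2}. \]
   Context: For integers $a,b$ and a positive integer $N$, $(a,b)_N=1$ means that every prime $p$ with $p\mid a$ and $p\mid b$ satisfies $p\mid N$; $(a,b)_N\ne 1$ means this fails. -}

module Defs where

open import Data.Nat using (ℕ; _*_; _≤_)
open import Data.Nat.Divisibility using (_∣_)
open import Data.Nat.Primality using (Prime; prime?)
open import Data.Integer using (ℤ; ∣_∣)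
open import Data.List using (List; filter; upTo)
open import Data.Nat.ListAction using (product)
open import Data.Product using (∃-syntax; _×_)
open import Relation.Nullary using (¬_)

primorialBelow : ℕ → ℕ
primorialBelow K = product (filter prime? (upTo K))

-- (A , B)_N ≠ 1 : some prime divides both A and B but does not divide N
NotCoprimeOutside : ℕ → ℤ → ℤ → Set
NotCoprimeOutside N A B =
  ∃[ p ] (Prime p × (p ∣ (∣ A ∣)) × (p ∣ (∣ B ∣)) × ¬ (p ∣ N))

-- |x| ≤ T where T = n / d  (d > 0)
InBox : ℕ → ℕ → ℤ → Set
InBox n d x = ∣ x ∣ * d ≤ n

-- Put m = ⌊n/d⌋, so the points lie in [-m, m]², and choose for each counted point (x, y) a
-- prime p ≥ K with p ∤ q dividing a + xq and b + yq; as p ∤ q, the possible x (and y) form a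
-- single residue class mod p. For each p ≤ 2m this leaves at most (2m/p + 1)² ≤ (4m/p)² points,
-- and Σ_{p ≥ K} 1/p² ≤ 1/(K - 1). If a + xq = 0 there is only one such x, hence at most 2m + 1
-- points. Otherwise p > 2m, so the points over a fixed x carry distinct primes p > 2m, all
-- dividing the nonzero number a + xq ≤ (m + 1)·max(q, |a|, 2); hence there are at most
-- log₂ max(q, |a|, 2) ≤ m/C of them. With K = 32f + 1 and C = 18f both groups have at most
-- m²/(2f) points, and (md)² ≤ n².
module Submission where

open import Defs
open import Data.Nat
  using (ℕ; zero; suc; _+_; _*_; _∸_; _^_; _≤_; _<_; _⊔_; z≤n; s≤s; _≟_; _≤?_;
         NonZero; >-nonZero; >-nonZero⁻¹; ≢-nonZero; nonTrivial⇒≢1)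
open import Data.Nat.Properties
open import Data.Nat.Divisibility using (_∣_; _∤_; divides; 1∣_; ∣1⇒≡1; ∣⇒≤; >⇒∤; ∣m⇒∣m*n; ∣n⇒∣m*n)
open import Data.Nat.DivMod using (_/_; _%_; m≡m%n+[m/n]*n; m%n<n; m/n*n≤m; m*n/n≡m; /-monoˡ-≤)
open import Data.Nat.Primality
  using (Prime; prime?; euclidsLemma; prime⇒irreducible; prime⇒nonTrivial; prime⇒nonZero)
open import Data.Nat.ListAction using (sum; product)
open import Data.Nat.ListAction.Properties using (∈⇒∣product)
open import Data.Nat.Tactic.RingSolver using (solve-∀)
open import Data.Integer using (ℤ; ∣_∣; +_; -[1+_]; _⊖_)
  renaming (_+_ to _+ℤ_; _*_ to _*ℤ_; _-_ to _-ℤ_)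
import Data.Integer.Properties as ℤ
import Data.Integer.Divisibility.Signed as ℤ∣
import Data.Integer.Tactic.RingSolver as ℤ-Solver
open import Data.List using (List; []; _∷_; length; map; filter; upTo; iterate)
open import Data.List.Properties using (length-upTo; length-map; map-cong)
open import Data.List.Membership.Propositional using (_∈_)
open import Data.List.Membership.Propositional.Properties using (∈-upTo⁺; ∈-filter⁺)
open import Data.List.Relation.Unary.Any using (here; there)
open import Data.List.Relation.Unary.All as All using (All; []; _∷_)
import Data.List.Relation.Unary.All.Properties as All
open import Data.List.Relation.Unary.AllPairs as AllPairs using (AllPairs; []; _∷_)
import Data.List.Relation.Unary.AllPairs.Properties as AllPairs
open import Data.List.Relation.Unary.Unique.Propositional using (Unique)
open import Data.List.Relation.Ternary.Interleaving.Properties using (interleave-length)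
import Data.List.Relation.Ternary.Interleaving.Propositional.Properties as Interleaving
open import Data.Product using (∃-syntax; _×_; _,_; proj₁; proj₂)
open import Data.Sum using (inj₁; inj₂; [_,_]′)
open import Data.Unit using (⊤; tt)
open import Data.Empty using (⊥-elim)
open import Function using (_∘_; id)
open import Relation.Nullary using (¬_; yes; no; ¬?)
open import Relation.Unary using (Decidable)
open import Relation.Binary.PropositionalEquality

sum-map-const : ∀ {A : Set} c (xs : List A) → sum (map (λ _ → c) xs) ≡ length xs * c
sum-map-const c []       = refl
sum-map-const c (_ ∷ xs) = cong (_+_ c) (sum-map-const c xs)

*≤⇒≤/ : ∀ j d n .{{_ : NonZero d}} → j * d ≤ n → j ≤ n / d
*≤⇒≤/ j d n j*d≤n = ≤-trans (≤-reflexive (sym (m*n/n≡m j d))) (/-monoˡ-≤ d j*d≤n)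

length-filter-split : ∀ {A : Set} {P : A → Set} (P? : Decidable P) xs →
                      length xs ≡ length (filter P? xs) + length (filter (¬? ∘ P?) xs)
length-filter-split P? xs = interleave-length (Interleaving.filter⁺ P? xs)

AllPairs-map-under-All : ∀ {A : Set} {G : A → Set} {R S : A → A → Set} →
  (∀ {u v} → G u → G v → R u v → S u v) → ∀ {xs} → All G xs → AllPairs R xs → AllPairs S xs
AllPairs-map-under-All f []         []         = []
AllPairs-map-under-All f (gx ∷ gxs) (rx ∷ rxs) =
  All.zipWith (λ (gy , rxy) → f gx gy rxy) (gxs , rx) ∷ AllPairs-map-under-All f gxs rxs

All-choose : ∀ {A B : Set} {P : A → Set} {Q : A × B → Set} → (∀ {a} → P a → ∃[ b ] Q (a , b)) →
             ∀ {xs} → All P xs → ∃[ ws ] map proj₁ ws ≡ xs × All Q ws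
All-choose choose []         = [] , refl , []
All-choose choose (px ∷ pxs) with choose px | All-choose choose pxs
... | b , qb | ws , refl , qws = (_ , b) ∷ ws , refl , qb ∷ qws

module _ {A : Set} {G : A → Set} {_#_ : A → A → Set} (key : A → ℕ) (bound : ℕ → ℕ)
         (fibre-≤ : ∀ r {V} → All G V → AllPairs _#_ V → All (λ v → key v ≡ r) V → length V ≤ bound r)
         where

  length-≤-sum-fibres : ∀ R {W} → All G W → AllPairs _#_ W → All (λ w → key w ∈ R) W →
                        length W ≤ sum (map bound R)
  length-≤-sum-fibres []      {[]}    _  _  _        = z≤n
  length-≤-sum-fibres []      {_ ∷ _} _  _  (() ∷ _)
  length-≤-sum-fibres (r ∷ R) {W}     gW #W keys = begin
    length W                                         ≡⟨ length-filter-split at-r? W ⟩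
    length (filter at-r? W) + length (filter off-r? W) ≤⟨ +-mono-≤ fibre-r rest ⟩
    bound r + sum (map bound R)                      ∎
    where
    open ≤-Reasoning
    at-r? : Decidable (λ w → key w ≡ r)
    at-r? w = key w ≟ r
    off-r? = ¬? ∘ at-r?
    fibre-r = fibre-≤ r (All.filter⁺ at-r? gW) (AllPairs.filter⁺ at-r? #W) (All.all-filter at-r? W)
    keys-off-r : All (λ w → key w ∈ R) (filter off-r? W)
    keys-off-r = All.zipWith (λ { (here eq , ne) → ⊥-elim (ne eq) ; (there k∈R , _) → k∈R })
                             (All.filter⁺ off-r? keys , All.all-filter off-r? W)
    rest = length-≤-sum-fibres R (All.filter⁺ off-r? gW) (AllPairs.filter⁺ off-r? #W) keys-off-r

  length-≤-uniform-fibres : ∀ N c → (∀ r → bound r ≡ c) → ∀ {W} → All G W → AllPairs _#_ W →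
                            All (λ w → key w < N) W → length W ≤ N * c
  length-≤-uniform-fibres N c bound≡c {W} gW #W keys<N = begin
    length W                     ≤⟨ length-≤-sum-fibres (upTo N) gW #W (All.map ∈-upTo⁺ keys<N) ⟩
    sum (map bound (upTo N))     ≡⟨ cong sum (map-cong bound≡c (upTo N)) ⟩
    sum (map (λ _ → c) (upTo N)) ≡⟨ sum-map-const c (upTo N) ⟩
    length (upTo N) * c          ≡⟨ cong (_* c) (length-upTo N) ⟩
    N * c                        ∎
    where open ≤-Reasoning

distinct-keys<⇒length≤ : ∀ {A : Set} (key : A → ℕ) N {W : List A} →
  AllPairs (λ u v → key u ≢ key v) W → All (λ w → key w < N) W → length W ≤ N
distinct-keys<⇒length≤ key N {W} #W keys<N =
  subst (length W ≤_) (*-identityʳ N)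
    (length-≤-uniform-fibres key (λ _ → 1) singleton N 1 (λ _ → refl) (All.universal (λ _ → tt) W) #W keys<N)
  where
  singleton : ∀ r {V} → All (λ _ → ⊤) V → AllPairs (λ u v → key u ≢ key v) V → All (λ v → key v ≡ r) V →
              length V ≤ 1
  singleton r {[]}        _ _              _              = z≤n
  singleton r {_ ∷ []}    _ _              _              = s≤s z≤n
  singleton r {_ ∷ _ ∷ _} _ ((ne ∷ _) ∷ _) (eq ∷ eq′ ∷ _) = ⊥-elim (ne (trans eq (sym eq′)))

∈-iterate-suc : ∀ {s p} j → s ≤ p → p < s + j → p ∈ iterate suc s j
∈-iterate-suc {s} {p} zero    s≤p p<s+0 = ⊥-elim (<⇒≱ p<s+0 (subst (_≤ p) (sym (+-identityʳ s)) s≤p))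
∈-iterate-suc {s} {p} (suc j) s≤p p<s+j with m≤n⇒m<n∨m≡n s≤p
... | inj₂ refl = here refl
... | inj₁ s<p  = there (∈-iterate-suc j s<p (subst (p <_) (+-suc s j) p<s+j))

-- The weights 1 / (t (t - 1)) telescope: their sum over k < t ≤ k + j is j / (k (k + j)).
telescoping-≤ : ∀ (g : ℕ → ℕ) B k j → (∀ t → k ≤ t → t < k + j → g (suc t) * suc t * t ≤ B) →
                sum (map g (iterate suc (suc k) j)) * k * (k + j) ≤ B * j
telescoping-≤ g B k zero    _     = z≤n
telescoping-≤ g B k (suc j) bound = *-cancelˡ-≤ (suc k) (begin
  suc k * ((G + S) * k * (k + suc j))                        ≡⟨ split G S k j ⟩
  G * suc k * k * (suc k + j) + k * (S * suc k * (suc k + j)) ≤⟨ +-mono-≤ (*-monoˡ-≤ (suc k + j) first)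
                                                                         (*-monoʳ-≤ k rest) ⟩
  B * (suc k + j) + k * (B * j)                              ≡⟨ merge B k j ⟩
  suc k * (B * suc j)                                        ∎)
  where
  open ≤-Reasoning
  G = g (suc k)
  S = sum (map g (iterate suc (suc (suc k)) j))
  first : G * suc k * k ≤ B
  first = bound k ≤-refl (m<m+n k (s≤s z≤n))
  rest : S * suc k * (suc k + j) ≤ B * j
  rest = telescoping-≤ g B (suc k) j λ t k<t t<k+j →
           bound t (<⇒≤ k<t) (subst (t <_) (sym (+-suc k j)) t<k+j)
  split : ∀ G S k j → suc k * ((G + S) * k * (k + suc j)) ≡
                      G * suc k * k * (suc k + j) + k * (S * suc k * (suc k + j))
  split = solve-∀
  merge : ∀ B k j → B * (suc k + j) + k * (B * j) ≡ suc k * (B * suc j)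
  merge = solve-∀

between : ℕ → ℕ → List ℕ
between k n = iterate suc (suc k) (n ∸ k)

∈-between : ∀ {k p n} → k < p → p ≤ n → p ∈ between k n
∈-between {k} {p} {n} k<p p≤n =
  ∈-iterate-suc (n ∸ k) k<p (subst (p <_) (cong suc (sym (m+[n∸m]≡n (≤-trans (<⇒≤ k<p) p≤n)))) (s≤s p≤n))

telescoping-≤′ : ∀ (g : ℕ → ℕ) B k n → 1 ≤ k →
                 (∀ t → k ≤ t → suc t ≤ n → g (suc t) * suc t * t ≤ B) →
                 sum (map g (between k n)) * k ≤ B
telescoping-≤′ g B k n 1≤k bound with k ≤? n
... | no k≰n rewrite m≤n⇒m∸n≡0 (<⇒≤ (≰⇒> k≰n)) = z≤n
... | yes k≤n = *-cancelʳ-≤ _ _ n {{>-nonZero (≤-trans 1≤k k≤n)}} (begin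
  S * k * n             ≡⟨ cong (S * k *_) (sym k+[n∸k]≡n) ⟩
  S * k * (k + (n ∸ k)) ≤⟨ telescoping-≤ g B k (n ∸ k) (λ t k≤t t<k+j →
                                                        bound t k≤t (subst (t <_) k+[n∸k]≡n t<k+j)) ⟩
  B * (n ∸ k)           ≤⟨ *-monoʳ-≤ B (m∸n≤m n k) ⟩
  B * n                 ∎)
  where
  open ≤-Reasoning
  S = sum (map g (between k n))
  k+[n∸k]≡n = m+[n∸m]≡n k≤n

prime≢1 : ∀ {p} → Prime p → p ≢ 1
prime≢1 p-prime = nonTrivial⇒≢1 {{prime⇒nonTrivial p-prime}}

prime∤product : ∀ {p} ps → Prime p → All Prime ps → All (p ≢_) ps → p ∤ product ps
prime∤product []       p-prime _ _ p∣1 = prime≢1 p-prime (∣1⇒≡1 p∣1)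
prime∤product (r ∷ rs) p-prime (r-prime ∷ rs-prime) (p≢r ∷ p≢rs) p∣r*rs
  with euclidsLemma r (product rs) p-prime p∣r*rs
... | inj₂ p∣rs = prime∤product rs p-prime rs-prime p≢rs p∣rs
... | inj₁ p∣r  with prime⇒irreducible r-prime p∣r
...   | inj₁ p≡1 = prime≢1 p-prime p≡1
...   | inj₂ p≡r = p≢r p≡r

distinct-primes-∣⇒product-∣ : ∀ {N} ps → All Prime ps → AllPairs _≢_ ps → All (_∣ N) ps → product ps ∣ N
distinct-primes-∣⇒product-∣ {N} []       _ _ _ = 1∣ N
distinct-primes-∣⇒product-∣ {N} (p ∷ ps) (p-prime ∷ ps-prime) (p∉ps ∷ ps-distinct) (p∣N ∷ ps∣N)
  with distinct-primes-∣⇒product-∣ ps ps-prime ps-distinct ps∣N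
... | divides t N≡t*ps with euclidsLemma t (product ps) p-prime (subst (p ∣_) N≡t*ps p∣N)
...   | inj₂ p∣ps            = ⊥-elim (prime∤product ps p-prime ps-prime p∉ps p∣ps)
...   | inj₁ (divides s t≡s*p) =
  divides s (trans N≡t*ps (trans (cong (_* product ps) t≡s*p) (*-assoc s p (product ps))))

All>⇒^length≤product : ∀ {B} ps → All (B <_) ps → suc B ^ length ps ≤ product ps
All>⇒^length≤product []       _          = ≤-refl
All>⇒^length≤product (p ∷ ps) (B<p ∷ B<ps) = *-mono-≤ B<p (All>⇒^length≤product ps B<ps)

p∣n<p⇒n≡0 : ∀ {p n} → p ∣ n → n < p → n ≡ 0
p∣n<p⇒n≡0 {n = zero}  _   _   = refl
p∣n<p⇒n≡0 {n = suc n} p∣n n<p = ⊥-elim (>⇒∤ n<p p∣n)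

p∣∣i-j∣<p⇒i≡j : ∀ {p} i j → p ∣ ∣ i -ℤ j ∣ → ∣ i -ℤ j ∣ < p → i ≡ j
p∣∣i-j∣<p⇒i≡j i j p∣∣i-j∣ ∣i-j∣<p =
  ℤ.i-j≡0⇒i≡j i j (ℤ.∣i∣≡0⇒i≡0 (p∣n<p⇒n≡0 p∣∣i-j∣ ∣i-j∣<p))

prime-∣-both⇒∣-diff : ∀ a x x' q {p} → Prime p → p ∤ q →
  p ∣ ∣ a +ℤ x *ℤ + q ∣ → p ∣ ∣ a +ℤ x' *ℤ + q ∣ → p ∣ ∣ x -ℤ x' ∣
prime-∣-both⇒∣-diff a x x' q {p} p-prime p∤q p∣A p∣A′ =
  [ id , ⊥-elim ∘ p∤q ]′ (euclidsLemma ∣ x -ℤ x' ∣ q p-prime p∣diff*q)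
  where
  difference : ∀ a x x' q → (a +ℤ x *ℤ q) -ℤ (a +ℤ x' *ℤ q) ≡ (x -ℤ x') *ℤ q
  difference = ℤ-Solver.solve-∀
  p∣diff*q : p ∣ ∣ x -ℤ x' ∣ * q
  p∣diff*q = subst (p ∣_) (trans (cong ∣_∣ (difference a x x' (+ q))) (ℤ.abs-* (x -ℤ x') (+ q)))
               (ℤ∣.∣⇒∣ᵤ {+ p} (ℤ∣.∣m∣n⇒∣m-n {+ p} {a +ℤ x *ℤ + q}
                                 (ℤ∣.∣ᵤ⇒∣ p∣A) (ℤ∣.∣ᵤ⇒∣ p∣A′)))

/≡⇒∣-∣< : ∀ u u' p .{{_ : NonZero p}} → u / p ≡ u' / p → ∣ + u -ℤ + u' ∣ < p
/≡⇒∣-∣< u u' p u/p≡u'/p = begin-strict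
  ∣ + u -ℤ + u' ∣                          ≡⟨ cong ∣_∣ (cong₂ _-ℤ_ (decompose u refl)
                                                                  (decompose u' (sym u/p≡u'/p))) ⟩
  ∣ (+ r +ℤ + Qp) -ℤ (+ r′ +ℤ + Qp) ∣      ≡⟨ cong ∣_∣ (cancel (+ r) (+ r′) (+ Qp)) ⟩
  ∣ + r -ℤ + r′ ∣                          ≡⟨ cong ∣_∣ (ℤ.m-n≡m⊖n r r′) ⟩
  ∣ r ⊖ r′ ∣                               ≤⟨ ℤ.∣m⊝n∣≤m⊔n r r′ ⟩
  r ⊔ r′                                   <⟨ ⊔-lub (m%n<n u p) (m%n<n u' p) ⟩
  p                                        ∎
  where
  open ≤-Reasoning
  r  = u % p
  r′ = u' % p
  Qp = u / p * p
  decompose : ∀ v → v / p ≡ u / p → + v ≡ + (v % p) +ℤ + Qp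
  decompose v v/p≡u/p = cong +_ (trans (m≡m%n+[m/n]*n v p) (cong (λ Q → v % p + Q * p) v/p≡u/p))
  cancel : ∀ r r′ c → (r +ℤ c) -ℤ (r′ +ℤ c) ≡ r -ℤ r′
  cancel = ℤ-Solver.solve-∀

shift : ℕ → ℤ → ℕ
shift m x = ∣ x +ℤ + m ∣

module _ {m : ℕ} where

  +shift : ∀ x → ∣ x ∣ ≤ m → + shift m x ≡ x +ℤ + m
  +shift (+ _)      _   = refl
  +shift -[1+ n ] n<m = trans (cong (+_ ∘ ∣_∣) m⊖1+n) (sym m⊖1+n)
    where m⊖1+n = ℤ.⊖-≥ n<m

  shift< : ∀ x → ∣ x ∣ ≤ m → shift m x < suc (m + m)
  shift< x x≤m = s≤s (≤-trans (ℤ.∣i+j∣≤∣i∣+∣j∣ x (+ m)) (+-monoˡ-≤ m x≤m))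

  module _ (x x' : ℤ) (x≤m : ∣ x ∣ ≤ m) (x'≤m : ∣ x' ∣ ≤ m) where

    shift-injective : shift m x ≡ shift m x' → x ≡ x'
    shift-injective eq = begin
      x                    ≡⟨ unshift x (+ m) ⟩
      (x +ℤ + m) -ℤ + m    ≡⟨ cong (_-ℤ + m) (trans (sym (+shift x x≤m)) (trans (cong +_ eq) (+shift x' x'≤m))) ⟩
      (x' +ℤ + m) -ℤ + m   ≡⟨ unshift x' (+ m) ⟨
      x'                   ∎
      where
      open ≡-Reasoning
      unshift : ∀ x m → x ≡ (x +ℤ m) -ℤ m
      unshift = ℤ-Solver.solve-∀

    ∣x-x'∣≤m+m : ∣ x -ℤ x' ∣ ≤ m + m
    ∣x-x'∣≤m+m = ≤-trans (ℤ.∣i-j∣≤∣i∣+∣j∣ x x') (+-mono-≤ x≤m x'≤m)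

    same-cell⇒∣-∣< : ∀ p .{{_ : NonZero p}} → shift m x / p ≡ shift m x' / p → ∣ x -ℤ x' ∣ < p
    same-cell⇒∣-∣< p same-cell =
      subst (_< p) (cong ∣_∣ (trans (cong₂ _-ℤ_ (+shift x x≤m) (+shift x' x'≤m)) (shifted x x' (+ m))))
        (/≡⇒∣-∣< (shift m x) (shift m x') p same-cell)
      where
      shifted : ∀ x x' m → (x +ℤ m) -ℤ (x' +ℤ m) ≡ x -ℤ x'
      shifted = ℤ-Solver.solve-∀

Marked : Set
Marked = (ℤ × ℤ) × ℕ

xOf : Marked → ℤ
xOf ((x , _) , _) = x

yOf : Marked → ℤ
yOf ((_ , y) , _) = y

primeOf : Marked → ℕ
primeOf = proj₂

Apart : Marked → Marked → Set
Apart u v = proj₁ u ≢ proj₁ v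

module Counting (a b : ℤ) (q : ℕ) .{{_ : NonZero q}} (m k : ℕ) where

  A : ℤ → ℤ
  A x = a +ℤ x *ℤ + q

  B : ℤ → ℤ
  B y = b +ℤ y *ℤ + q

  diam : ℕ
  diam = m + m

  record Good (w : Marked) : Set where
    field
      x≤m   : ∣ xOf w ∣ ≤ m
      y≤m   : ∣ yOf w ∣ ≤ m
      prime : Prime (primeOf w)
      k<p   : k < primeOf w
      p∤q   : primeOf w ∤ q
      p∣A   : primeOf w ∣ ∣ A (xOf w) ∣
      p∣B   : primeOf w ∣ ∣ B (yOf w) ∣
  open Good

  module _ (c x x' : ℤ) {p : ℕ} .{{_ : NonZero p}} (x≤m : ∣ x ∣ ≤ m) (x'≤m : ∣ x' ∣ ≤ m)
           (p-prime : Prime p) (p∤q : p ∤ q)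
           (p∣cx : p ∣ ∣ c +ℤ x *ℤ + q ∣) (p∣cx' : p ∣ ∣ c +ℤ x' *ℤ + q ∣) where

    same-cell⇒≡ : shift m x / p ≡ shift m x' / p → x ≡ x'
    same-cell⇒≡ same-cell = p∣∣i-j∣<p⇒i≡j x x' (prime-∣-both⇒∣-diff c x x' q p-prime p∤q p∣cx p∣cx')
      (same-cell⇒∣-∣< x x' x≤m x'≤m p same-cell)

    diam<p⇒≡ : diam < p → x ≡ x'
    diam<p⇒≡ diam<p = p∣∣i-j∣<p⇒i≡j x x' (prime-∣-both⇒∣-diff c x x' q p-prime p∤q p∣cx p∣cx')
      (≤-<-trans (∣x-x'∣≤m+m x x' x≤m x'≤m) diam<p)

  A-root-unique : ∀ x x' → ∣ A x ∣ ≡ 0 → ∣ A x' ∣ ≡ 0 → x ≡ x'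
  A-root-unique x x' ∣Ax∣≡0 ∣Ax'∣≡0 = ℤ.*-cancelʳ-≡ x x' (+ q) (begin
    x *ℤ + q        ≡⟨ coefficient x ⟩
    A x -ℤ a        ≡⟨ cong (_-ℤ a) (trans (ℤ.∣i∣≡0⇒i≡0 {A x} ∣Ax∣≡0)
                                           (sym (ℤ.∣i∣≡0⇒i≡0 {A x'} ∣Ax'∣≡0))) ⟩
    A x' -ℤ a       ≡⟨ coefficient x' ⟨
    x' *ℤ + q       ∎)
    where
    open ≡-Reasoning
    solved : ∀ a x q → x *ℤ q ≡ (a +ℤ x *ℤ q) -ℤ a
    solved = ℤ-Solver.solve-∀
    coefficient : ∀ x → x *ℤ + q ≡ A x -ℤ a
    coefficient x = solved a x (+ q)

  count-root-points : ∀ {W} → All (λ w → Good w × ∣ A (xOf w) ∣ ≡ 0) W → AllPairs Apart W → length W ≤ suc diam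
  count-root-points gW #W =
    distinct-keys<⇒length≤ (shift m ∘ yOf) (suc diam) (AllPairs-map-under-All distinct-rows gW #W)
      (All.map (λ {w} (g , _) → shift< (yOf w) (y≤m g)) gW)
    where
    distinct-rows : ∀ {u v} → Good u × ∣ A (xOf u) ∣ ≡ 0 → Good v × ∣ A (xOf v) ∣ ≡ 0 → Apart u v →
                    shift m (yOf u) ≢ shift m (yOf v)
    distinct-rows {(x , y) , _} {(x' , y') , _} (g , Ax≡0) (g' , Ax'≡0) apart same-row =
      apart (cong₂ _,_ (A-root-unique x x' Ax≡0 Ax'≡0) (shift-injective y y' (y≤m g) (y≤m g') same-row))

  -- The fibre over p = 0 is empty, so the value of cells 0 does not matter.
  cells : ℕ → ℕ
  cells zero      = 0
  cells p@(suc _) = suc (diam / p)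

  SmallGood : Marked → Set
  SmallGood w = Good w × primeOf w ≤ diam

  -- A point carrying the prime p is determined by the cells ⌊(x + m)/p⌋ and ⌊(y + m)/p⌋ of its
  -- coordinates, because x and y are fixed mod p.
  small-prime-fibre-≤ : ∀ r {V} → All SmallGood V → AllPairs Apart V → All (λ v → primeOf v ≡ r) V →
                        length V ≤ cells r * cells r
  small-prime-fibre-≤ zero      {[]}    _             _  _           = z≤n
  small-prime-fibre-≤ zero      {_ ∷ _} ((g , _) ∷ _) _  (refl ∷ _) with () ← k<p g
  small-prime-fibre-≤ p@(suc _) {V}     gV            #V p≡ =
    length-≤-uniform-fibres column (λ _ → cells p) column-≤ (cells p) (cells p) (λ _ → refl)
      gV′ #V (All.map (λ {w} ((g , _) , _) → cell< (xOf w) (x≤m g)) gV′)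
    where
    gV′ = All.zip (gV , p≡)
    column : Marked → ℕ
    column w = shift m (xOf w) / p
    row : Marked → ℕ
    row w = shift m (yOf w) / p
    cell< : ∀ x → ∣ x ∣ ≤ m → shift m x / p < cells p
    cell< x x≤m = s≤s (/-monoˡ-≤ p (≤-pred (shift< x x≤m)))
    InFibre : Marked → Set
    InFibre w = SmallGood w × primeOf w ≡ p
    distinct-rows : ∀ {c u v} → InFibre u × column u ≡ c → InFibre v × column v ≡ c → Apart u v → row u ≢ row v
    distinct-rows {_} {(x , y) , _} {(x' , y') , _} (((g , _) , refl) , cx) (((g' , _) , refl) , cx') apart same-row =
      apart (cong₂ _,_
        (same-cell⇒≡ a x x' (x≤m g) (x≤m g') (prime g) (p∤q g) (p∣A g) (p∣A g') (trans cx (sym cx')))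
        (same-cell⇒≡ b y y' (y≤m g) (y≤m g') (prime g) (p∤q g) (p∣B g) (p∣B g') same-row))
    column-≤ : ∀ c {U} → All InFibre U → AllPairs Apart U → All (λ u → column u ≡ c) U → length U ≤ cells p
    column-≤ c gU #U c≡ =
      distinct-keys<⇒length≤ row (cells p) (AllPairs-map-under-All distinct-rows (All.zip (gU , c≡)) #U)
        (All.map (λ {w} ((g , _) , _) → cell< (yOf w) (y≤m g)) gU)

  cells²-≤ : ∀ t → suc t ≤ diam → cells (suc t) * cells (suc t) * suc t * t ≤ (diam + diam) * (diam + diam)
  cells²-≤ t p≤diam = begin
    c * c * p * t       ≤⟨ *-monoʳ-≤ (c * c * p) (n≤1+n t) ⟩
    c * c * p * p       ≡⟨ regroup c p ⟩
    (c * p) * (c * p)   ≤⟨ *-mono-≤ c*p≤ c*p≤ ⟩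
    (diam + diam) * (diam + diam) ∎
    where
    open ≤-Reasoning
    p = suc t
    c = cells p
    c*p≤ : c * p ≤ diam + diam
    c*p≤ = +-mono-≤ p≤diam (m/n*n≤m diam p)
    regroup : ∀ c p → c * c * p * p ≡ (c * p) * (c * p)
    regroup = solve-∀

  count-small-primes : 1 ≤ k → ∀ {W} → All SmallGood W → AllPairs Apart W →
                       length W * k ≤ (diam + diam) * (diam + diam)
  count-small-primes 1≤k {W} gW #W = begin
    length W * k                                             ≤⟨ *-monoˡ-≤ k fibres ⟩
    sum (map (λ p → cells p * cells p) (between k diam)) * k ≤⟨ telescoping-≤′ _ _ k diam 1≤k
                                                                  (λ t _ → cells²-≤ t) ⟩
    (diam + diam) * (diam + diam)                            ∎
    where
    open ≤-Reasoning
    fibres = length-≤-sum-fibres primeOf (λ p → cells p * cells p) small-prime-fibre-≤ (between k diam) gW #W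
               (All.map (λ (g , p≤diam) → ∈-between (k<p g) p≤diam) gW)

  LargeGood : Marked → Set
  LargeGood w = Good w × diam < primeOf w × ∣ A (xOf w) ∣ ≢ 0

  module LargePrimes (M C : ℕ) .{{_ : NonZero C}} (∣a∣≤M : ∣ a ∣ ≤ M) (q≤M : q ≤ M) (2≤M : 2 ≤ M)
                     (log₂-bound : ∀ j → 2 ^ j ≤ M → j * C ≤ m) where

    C≤m : C ≤ m
    C≤m = subst (_≤ m) (*-identityˡ C) (log₂-bound 1 2≤M)

    1≤m : 1 ≤ m
    1≤m = ≤-trans (>-nonZero⁻¹ C) C≤m

    ∣A∣≤ : ∀ x → ∣ x ∣ ≤ m → ∣ A x ∣ ≤ suc m * M
    ∣A∣≤ x x≤m = begin
      ∣ A x ∣               ≤⟨ ℤ.∣i+j∣≤∣i∣+∣j∣ a (x *ℤ + q) ⟩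
      ∣ a ∣ + ∣ x *ℤ + q ∣  ≡⟨ cong (_+_ ∣ a ∣) (ℤ.abs-* x (+ q)) ⟩
      ∣ a ∣ + ∣ x ∣ * q     ≤⟨ +-mono-≤ ∣a∣≤M (*-mono-≤ x≤m q≤M) ⟩
      M + m * M             ∎
      where open ≤-Reasoning

    same-x-fibre-≤ : ∀ s {V} → All LargeGood V → AllPairs Apart V → All (λ v → shift m (xOf v) ≡ s) V →
            length V ≤ suc (m / C)
    same-x-fibre-≤ s {[]}    _  _  _    = z≤n
    same-x-fibre-≤ s {w ∷ V} gV #V s≡ = s≤s (*≤⇒≤/ (length V) C m (log₂-bound (length V) 2^j≤M))
      where
      x₀ = xOf w
      g₀ = proj₁ (All.head gV)
      N  = ∣ A x₀ ∣
      ps = map primeOf (w ∷ V)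
      InFibre : Marked → Set
      InFibre v = LargeGood v × shift m (xOf v) ≡ s
      same-x : ∀ {v} → InFibre v → xOf v ≡ x₀
      same-x {v} ((g , _) , sv) = shift-injective (xOf v) x₀ (x≤m g) (x≤m g₀) (trans sv (sym (All.head s≡)))
      distinct-primes : ∀ {u v} → InFibre u → InFibre v → Apart u v → primeOf u ≢ primeOf v
      distinct-primes {(x , y) , p} {(x' , y') , .p} hu@((g , diam<p , _) , _) hv@((g' , _) , _) apart refl =
        apart (cong₂ _,_ (trans (same-x hu) (sym (same-x hv)))
                         (diam<p⇒≡ b y y' {{prime⇒nonZero (prime g)}} (y≤m g) (y≤m g')
                                   (prime g) (p∤q g) (p∣B g) (p∣B g') diam<p))
      gV′ = All.zip (gV , s≡)
      product≤N : product ps ≤ N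
      product≤N = ∣⇒≤ {{≢-nonZero (proj₂ (proj₂ (All.head gV)))}}
        (distinct-primes-∣⇒product-∣ ps (All.map⁺ (All.map (prime ∘ proj₁ ∘ proj₁) gV′))
          (AllPairs.map⁺ (AllPairs-map-under-All distinct-primes gV′ #V))
          (All.map⁺ (All.map (λ {v} h → subst (λ z → primeOf v ∣ ∣ A z ∣) (same-x h) (p∣A (proj₁ (proj₁ h))))
                             gV′)))
      chain : suc diam * suc diam ^ length V ≤ suc diam * M
      chain = begin
        suc diam ^ length (w ∷ V) ≡⟨ cong (suc diam ^_) (length-map primeOf (w ∷ V)) ⟨
        suc diam ^ length ps      ≤⟨ All>⇒^length≤product ps (All.map⁺ (All.map (proj₁ ∘ proj₂) gV)) ⟩
        product ps                ≤⟨ product≤N ⟩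
        N                         ≤⟨ ∣A∣≤ x₀ (x≤m g₀) ⟩
        suc m * M                 ≤⟨ *-monoˡ-≤ M (s≤s (m≤m+n m m)) ⟩
        suc diam * M              ∎
        where open ≤-Reasoning
      2^j≤M : 2 ^ length V ≤ M
      2^j≤M = ≤-trans (^-monoˡ-≤ (length V) (s≤s (≤-trans 1≤m (m≤m+n m m)))) (*-cancelˡ-≤ (suc diam) chain)

    count-large-primes : ∀ {W} → All LargeGood W → AllPairs Apart W → length W ≤ suc diam * suc (m / C)
    count-large-primes gW #W =
      length-≤-uniform-fibres (shift m ∘ xOf) (λ _ → suc (m / C)) same-x-fibre-≤ (suc diam) (suc (m / C)) (λ _ → refl)
        gW #W (All.map (λ {w} (g , _) → shift< (xOf w) (x≤m g)) gW)

    root-and-large-share : ∀ L₁ L₄ → L₁ ≤ suc diam → L₄ ≤ suc diam * suc (m / C) →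
                           (L₁ + L₄) * C ≤ 9 * (m * m)
    root-and-large-share L₁ L₄ L₁≤ L₄≤ = begin
      (L₁ + L₄) * C                                ≤⟨ *-monoˡ-≤ C (+-mono-≤ L₁≤ L₄≤) ⟩
      (suc diam + suc diam * suc (m / C)) * C      ≡⟨ factor (suc diam) C (m / C) ⟩
      suc diam * (C + (C + m / C * C))             ≤⟨ *-mono-≤ (+-monoˡ-≤ diam 1≤m)
                                                               (+-mono-≤ C≤m (+-mono-≤ C≤m (m/n*n≤m m C))) ⟩
      (m + diam) * (m + diam)                      ≡⟨ nine m ⟩
      9 * (m * m)                                  ∎
      where
      open ≤-Reasoning
      factor : ∀ D C Q → (D + D * (1 + Q)) * C ≡ D * (C + (C + Q * C))
      factor = solve-∀
      nine : ∀ m → (m + (m + m)) * (m + (m + m)) ≡ 9 * (m * m)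
      nine = solve-∀

    count-good : 1 ≤ k → ∀ {W} → All Good W → AllPairs Apart W →
                 length W * (k * C) ≤ (16 * C + 9 * k) * (m * m)
    count-good 1≤k {W} gW #W = begin
      length W * (k * C)                        ≡⟨ cong (_* (k * C)) (length-filter-split small? W) ⟩
      (length W₃ + length Wᵣ) * (k * C)          ≡⟨ cong (λ L → (length W₃ + L) * (k * C))
                                                        (length-filter-split root? Wᵣ) ⟩
      (length W₃ + (length W₁ + length W₄)) * (k * C) ≡⟨ regroup (length W₃) (length W₁ + length W₄) k C ⟩
      length W₃ * k * C + (length W₁ + length W₄) * C * k
        ≤⟨ +-mono-≤ (*-monoˡ-≤ C small-share) (*-monoˡ-≤ k large-share) ⟩
      16 * (m * m) * C + 9 * (m * m) * k        ≡⟨ collect (m * m) k C ⟩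
      (16 * C + 9 * k) * (m * m)                ∎
      where
      open ≤-Reasoning
      regroup : ∀ L₃ L₁₄ k C → (L₃ + L₁₄) * (k * C) ≡ L₃ * k * C + L₁₄ * C * k
      regroup = solve-∀
      sixteen : ∀ m → (m + m + (m + m)) * (m + m + (m + m)) ≡ 16 * (m * m)
      sixteen = solve-∀
      collect : ∀ M k C → 16 * M * C + 9 * M * k ≡ (16 * C + 9 * k) * M
      collect = solve-∀
      small? = λ w → primeOf w ≤? diam
      root?  = λ w → ∣ A (xOf w) ∣ ≟ 0
      W₃ = filter small? W
      Wᵣ = filter (¬? ∘ small?) W
      W₁ = filter root? Wᵣ
      W₄ = filter (¬? ∘ root?) Wᵣ
      gWᵣ : All (λ w → Good w × diam < primeOf w) Wᵣ
      gWᵣ = All.zip (All.filter⁺ (¬? ∘ small?) gW , All.map ≰⇒> (All.all-filter (¬? ∘ small?) W))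
      #Wᵣ = AllPairs.filter⁺ (¬? ∘ small?) #W
      small-share : length W₃ * k ≤ 16 * (m * m)
      small-share = subst (length W₃ * k ≤_) (sixteen m)
        (count-small-primes 1≤k (All.zip (All.filter⁺ small? gW , All.all-filter small? W)) (AllPairs.filter⁺ small? #W))
      large-share : (length W₁ + length W₄) * C ≤ 9 * (m * m)
      large-share = root-and-large-share (length W₁) (length W₄)
        (count-root-points (All.zip (All.map proj₁ (All.filter⁺ root? gWᵣ) , All.all-filter root? Wᵣ))
                           (AllPairs.filter⁺ root? #Wᵣ))
        (count-large-primes (All.zipWith (λ ((g , diam<p) , A≢0) → g , diam<p , A≢0)
                                         (All.filter⁺ (¬? ∘ root?) gWᵣ , All.all-filter (¬? ∘ root?) Wᵣ))
                            (AllPairs.filter⁺ (¬? ∘ root?) #Wᵣ))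

^-cancelʳ-< : ∀ m .{{_ : NonZero m}} {i j} → m ^ i < m ^ j → i < j
^-cancelʳ-< m m^i<m^j = ≰⇒> (λ j≤i → <⇒≱ m^i<m^j (^-monoʳ-≤ m j≤i))

exponent-bound : ∀ M C d n .{{_ : NonZero d}} → M ^ (C * d) < 2 ^ n → ∀ j → 2 ^ j ≤ M → j * C ≤ n / d
exponent-bound M C d n M^Cd<2^n j 2^j≤M = *≤⇒≤/ (j * C) d n (<⇒≤ (^-cancelʳ-< 2 (begin-strict
  2 ^ (j * C * d)     ≡⟨ cong (2 ^_) (*-assoc j C d) ⟩
  2 ^ (j * (C * d))   ≡⟨ ^-*-assoc 2 j (C * d) ⟨
  (2 ^ j) ^ (C * d)   ≤⟨ ^-monoˡ-≤ (C * d) 2^j≤M ⟩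
  M ^ (C * d)         <⟨ M^Cd<2^n ⟩
  2 ^ n               ∎)))
  where open ≤-Reasoning

Counted : ℕ → ℕ → ℤ → ℤ → ℕ → ℕ → ℤ × ℤ → Set
Counted N q a b n d (x , y) = InBox n d x × InBox n d y × NotCoprimeOutside N (a +ℤ x *ℤ + q) (b +ℤ y *ℤ + q)

module _ (a b : ℤ) (q : ℕ) .{{_ : NonZero q}} (n d : ℕ) .{{_ : NonZero d}} (k : ℕ) where

  open Counting a b q (n / d) k

  counted⇒good : ∀ {xy} → Counted (primorialBelow (suc k) * q) q a b n d xy → ∃[ p ] Good (xy , p)
  counted⇒good {x , y} (x-in-box , y-in-box , p , p-prime , p∣A , p∣B , p∤Pq) = p , record
    { x≤m   = *≤⇒≤/ ∣ x ∣ d n x-in-box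
    ; y≤m   = *≤⇒≤/ ∣ y ∣ d n y-in-box
    ; prime = p-prime
    ; k<p   = k<p
    ; p∤q   = p∤Pq ∘ ∣n⇒∣m*n (primorialBelow (suc k))
    ; p∣A   = p∣A
    ; p∣B   = p∣B
    }
    where
    k<p : k < p
    k<p with suc k ≤? p
    ... | yes k<p = k<p
    ... | no  k≮p =
      ⊥-elim (p∤Pq (∣m⇒∣m*n q (∈⇒∣product (∈-filter⁺ prime? (∈-upTo⁺ (≰⇒> k≮p)) p-prime))))

counted-points-bound : ∀ f → 0 < f → (a b : ℤ) (q : ℕ) → 0 < q → (n d : ℕ) → 0 < d →
  (q ⊔ (∣ a ∣ ⊔ 2)) ^ (18 * f * d) < 2 ^ n → (L : List (ℤ × ℤ)) → Unique L →
  All (Counted (primorialBelow (suc (32 * f)) * q) q a b n d) L → length L * f * d ^ 2 ≤ n ^ 2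
counted-points-bound f@(suc _) _ a b q@(suc _) _ n d@(suc _) _ M^Cd<2^n L unique counted
  with All-choose (counted⇒good a b q n d (32 * f)) counted
... | W , refl , gW = begin
  length (map proj₁ W) * f * d ^ 2    ≡⟨ cong (λ l → l * f * d ^ 2) (length-map proj₁ W) ⟩
  length W * f * d ^ 2                ≤⟨ *-monoˡ-≤ (d ^ 2) length-W*f≤ ⟩
  m * m * d ^ 2                       ≡⟨ square m d ⟩
  (m * d) * (m * d)                   ≤⟨ *-mono-≤ (m/n*n≤m n d) (m/n*n≤m n d) ⟩
  n * n                               ≡⟨ cong (n *_) (*-identityʳ n) ⟨
  n ^ 2                               ∎
  where
  open ≤-Reasoning
  k = 32 * f
  C = 18 * f
  m = n / d
  M = q ⊔ (∣ a ∣ ⊔ 2)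
  open Counting a b q m k
  open LargePrimes M C (≤-trans (m≤m⊔n ∣ a ∣ 2) (m≤n⊔m q (∣ a ∣ ⊔ 2))) (m≤m⊔n q (∣ a ∣ ⊔ 2))
                   (≤-trans (m≤n⊔m ∣ a ∣ 2) (m≤n⊔m q (∣ a ∣ ⊔ 2))) (exponent-bound M C d n M^Cd<2^n)
  length-W*f≤ : length W * f ≤ m * m
  length-W*f≤ = *-cancelʳ-≤ _ _ (576 * f) (subst₂ _≤_ (lhs (length W) f) (rhs f (m * m))
                  (count-good (s≤s z≤n) gW (AllPairs.map⁻ unique)))
    where
    lhs : ∀ L f → L * (32 * f * (18 * f)) ≡ L * f * (576 * f)
    lhs = solve-∀
    rhs : ∀ f M → (16 * (18 * f) + 9 * (32 * f)) * M ≡ M * (576 * f)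
    rhs = solve-∀
  square : ∀ m d → m * m * (d * (d * 1)) ≡ (m * d) * (m * d)
  square = solve-∀

lemma4p4 : (e f : ℕ) → 0 < e → 0 < f →
  ∃[ K ] ∃[ C ] (0 < K × 0 < C ×
    ((a b : ℤ) (q : ℕ) → 0 < q → (n d : ℕ) → 0 < d →
      (q ⊔ (∣ a ∣ ⊔ 2)) ^ (C * d) < 2 ^ n →
      (L : List (ℤ × ℤ)) → Unique L →
      All (λ { (x , y) → InBox n d x × InBox n d y ×
             NotCoprimeOutside (primorialBelow K * q) (a +ℤ x *ℤ + q) (b +ℤ y *ℤ + q) }) L →
      length L * f * (d ^ 2) ≤ e * (n ^ 2)))
lemma4p4 e zero      _   ()
lemma4p4 e f@(suc _) 0<e 0<f = suc (32 * f) , 18 * f , s≤s z≤n , s≤s z≤n ,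
  λ a b q 0<q n d 0<d M^Cd<2^n L unique counted →
    -- the All.map only unfolds the pattern-matching predicate of the statement to Counted
    ≤-trans (counted-points-bound f 0<f a b q 0<q n d 0<d M^Cd<2^n L unique (All.map (λ { {_ , _} c → c }) counted))
            (m≤n*m (n ^ 2) e {{>-nonZero 0<e}})
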